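{- Let $q$ be an odd prime. Every shortened proper array code (PAC) with modulus $q$ and column weight $r\ge 3$ whose parity-check matrix retains at least two block-columns has girth at most eight.
   Context: For integers $a\le b$, $[a,b]=\{x\in\mathbb{Z}: a\le x\le b\}$. Let $q$ be an odd prime, $I$ the $q\times q$ identity matrix and $P\ne I$ a $q\times q$ circulant permutation matrix. Given $r\in[1,q]$ and distinct integers $a_0,\dots,a_{r-1}\in[0,q-1]$, the array code with modulus $q$ has parity-check matrix $H$ formed by an $r\times q$ array of $q\times q$ blocks, the block in block-row $i\in[0,r-1]$ and block-column $j\in[0,q-1]$ being $P^{a_i\cdot j}$; its column weight is $r$. It is a proper array code (PAC) if $a_0,\dots,a_{r-1}$ is an arithmetic progression with nonzero common difference. A shortened array code is the code whose parity-check matrix is obtained from $H$ by deleting a set of block-columns. The girth of a code is the length of a shortest cycle in its Tanner graph (the bipartite graph with a vertex for each column and each row of the parity-check matrix, column and row vertices adjacent iff the corresponding entry is $1$). -}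

module Defs where

open import Data.Nat using (ℕ; zero; suc; _+_; _*_; _<_; _≤_; NonZero)
open import Data.Nat.DivMod using (_mod_)
open import Data.Fin using (Fin; toℕ; _≟_)
import Data.Fin as F
open import Data.Fin.Subset using (Subset; _∈_; ∣_∣)
open import Data.Integer as ℤ using (ℤ; +_)
open import Data.Product using (Σ; _×_; _,_; ∃)
open import Data.Sum using (_⊎_)
open import Data.Nat.Primality using (Prime)
open import Function.Definitions using (Injective)
open import Relation.Binary.PropositionalEquality using (_≡_; _≢_)
open import Relation.Nullary using (¬_; yes; no)

-- q × q matrices over ℕ (entries used are 0/1)
Mat : ℕ → Set
Mat n = Fin n → Fin n → ℕ

sumFin : (n : ℕ) → (Fin n → ℕ) → ℕ
sumFin zero    f = 0
sumFin (suc n) f = f F.zero + sumFin n (λ i → f (F.suc i))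

identity : (n : ℕ) → Mat n
identity n i j with i ≟ j
... | yes _ = 1
... | no  _ = 0

_⊗_ : {n : ℕ} → Mat n → Mat n → Mat n
_⊗_ {n} A B i k = sumFin n (λ j → A i j * B j k)

matPow : {n : ℕ} → Mat n → ℕ → Mat n
matPow {n} P zero    = identity n
matPow {n} P (suc e) = P ⊗ matPow P e

next : {n : ℕ} → Fin n → Fin n
next {suc n} i = suc (toℕ i) mod (suc n)

IsPermutationMatrix : {n : ℕ} → Mat n → Set
IsPermutationMatrix {n} P =
  (∀ i j → (P i j ≡ 0) ⊎ (P i j ≡ 1)) ×
  (∀ i → Σ (Fin n) λ j → (P i j ≡ 1) × (∀ j' → P i j' ≡ 1 → j' ≡ j)) ×
  (∀ j → Σ (Fin n) λ i → (P i j ≡ 1) × (∀ i' → P i' j ≡ 1 → i' ≡ i))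

IsCirculant : {n : ℕ} → Mat n → Set
IsCirculant {n} P = ∀ i j → P (next i) (next j) ≡ P i j

IsCirculantPermutationMatrix : {n : ℕ} → Mat n → Set
IsCirculantPermutationMatrix P = IsPermutationMatrix P × IsCirculant P

IsProperAP : {r : ℕ} → (Fin r → ℕ) → Set
IsProperAP {zero}  a = Data.Product.Σ ℤ (λ d → d ≢ ℤ.0ℤ)
IsProperAP {suc r} a =
  Σ ℤ λ d → (d ≢ ℤ.0ℤ) × (∀ i → + a i ≡ + a F.zero ℤ.+ (+ toℕ i) ℤ.* d)

-- Parity-check matrix H of the array code: rows indexed by
-- (block-row i, row c within block), columns by (block-column j, column c within block).
-- Entry is the (ρ,c) entry of P^(a_i · j).
RowV : ℕ → ℕ → Set
RowV r q = Fin r × Fin q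

ColV : ℕ → Set
ColV q = Fin q × Fin q

entryH : {r q : ℕ} → Mat q → (Fin r → ℕ) → RowV r q → ColV q → ℕ
entryH P a (i , ρ) (j , c) = matPow P (a i * toℕ j) ρ c

-- Tanner graph of the shortened code (block-columns kept = S):
-- row vertex v adjacent to column vertex w iff w's block-column is in S and H[v,w] = 1
Adj : {r q : ℕ} → Mat q → (Fin r → ℕ) → Subset q → RowV r q → ColV q → Set
Adj P a S v (j , c) = (j ∈ S) × (entryH P a v (j , c) ≡ 1)

-- A cycle of length 2k (k ≥ 2) in the bipartite Tanner graph:
-- distinct column vertices w_0..w_{k-1}, distinct row vertices v_0..v_{k-1},
-- with w_t ~ v_t ~ w_{t+1 mod k}.
record Cycle {r q : ℕ} (P : Mat q) (a : Fin r → ℕ) (S : Subset q) (k : ℕ) : Set where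
  field
    two≤k  : 2 ≤ k
    cols   : Fin k → ColV q
    rows   : Fin k → RowV r q
    colsInj : Injective _≡_ _≡_ cols
    rowsInj : Injective _≡_ _≡_ rows
    adj₁   : ∀ t → Adj P a S (rows t) (cols t)
    adj₂   : ∀ t → Adj P a S (rows t) (cols (next t))

GirthAtMost : {r q : ℕ} → Mat q → (Fin r → ℕ) → Subset q → ℕ → Set
GirthAtMost P a S g = Σ ℕ λ k → (2 * k ≤ g) × Cycle P a S k

-- A circulant permutation matrix P is the shift x ↦ x + s (mod q) with s ≢ 0 when P ≠ I, so
-- the block P^(a·j) sends row ρ to column ρ + a j s.  Take block-rows with values x, y, z in
-- arithmetic progression (x + z = 2y) and block-columns u < v.  The closed walk
--   (u, c₀) — (x, r₀) — (v, c₁) — (y, r₁) — (u, c₂) — (z, r₂) — (v, c₃) — (y, r₃) — (u, c₀)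
-- closes up because its total displacement is (x − y + z − y)(v − u)s = 0, and it is a
-- genuine 8-cycle because two of its vertices in the same block could only coincide if q
-- divided (x − y)(v − u)s or (z − y)(v − u)s, products of nonzero numbers below the prime q.
module Submission where

open import Defs
open import Data.Nat using (ℕ; zero; suc; _+_; _*_; _≤_; _<_; _%_; z≤n; s≤s; NonZero)
open import Data.Nat.Properties
  using (≤-refl; +-identityʳ; +-comm; +-cancelʳ-≡; m≤n+m; ≤-<-trans; <-cmp; <-irrefl; m≤n⇒∃[o]m+o≡n)
open import Data.Nat.DivMod using (_mod_; %-distribˡ-+; m%n%n≡m%n; m<n⇒m%n≡m; m≡m%n+[m/n]*n; _/_)
open import Data.Nat.Divisibility using (_∣_; divides; >⇒∤)
open import Data.Nat.Primality using (Prime; euclidsLemma)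
open import Data.Nat.Tactic.RingSolver using (solve-∀)
open import Data.Fin using (Fin; toℕ; _≟_) renaming (zero to fzero; suc to fsuc)
open import Data.Fin.Patterns using (0F; 1F; 2F; 3F)
open import Data.Fin.Properties using (toℕ-injective; toℕ-fromℕ<; toℕ<n; suc-injective)
open import Data.Fin.Subset using (Subset; _∈_; ∣_∣; inside; outside; Nonempty)
open import Data.Vec.Base using (_∷_; []; here; there)
import Data.Integer as ℤ
import Data.Integer.Properties as ℤ
import Data.Integer.Tactic.RingSolver as ℤ-Solver
open import Data.Product using (∃₂; _×_; _,_; proj₁; proj₂)
open import Data.Sum using (inj₁; inj₂)
open import Function using (_∘_)
open import Function.Definitions using (Injective)
open import Relation.Binary.Definitions using (tri<; tri≈; tri>)
open import Relation.Binary.PropositionalEquality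
open import Relation.Nullary using (¬_; yes; no; contradiction)

sumFin-≡0 : ∀ n (f : Fin n → ℕ) → (∀ j → f j ≡ 0) → sumFin n f ≡ 0
sumFin-≡0 zero    f f≡0 = refl
sumFin-≡0 (suc n) f f≡0 rewrite f≡0 fzero = sumFin-≡0 n (f ∘ fsuc) (f≡0 ∘ fsuc)

sumFin-single : ∀ n (f : Fin n → ℕ) (k : Fin n) → (∀ j → j ≢ k → f j ≡ 0) → sumFin n f ≡ f k
sumFin-single (suc n) f fzero    f≡0 =
  trans (cong (f fzero +_) (sumFin-≡0 n (f ∘ fsuc) (λ j → f≡0 (fsuc j) λ ()))) (+-identityʳ _)
sumFin-single (suc n) f (fsuc k) f≡0 rewrite f≡0 fzero (λ ()) =
  sumFin-single n (f ∘ fsuc) k (λ j j≢k → f≡0 (fsuc j) (j≢k ∘ suc-injective))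

identity-diag : ∀ n (i : Fin n) → identity n i i ≡ 1
identity-diag n i with i ≟ i
... | yes _  = refl
... | no i≢i = contradiction refl i≢i

injective₄ : {A : Set} (f : Fin 4 → A) →
  f 0F ≢ f 1F → f 0F ≢ f 2F → f 0F ≢ f 3F → f 1F ≢ f 2F → f 1F ≢ f 3F → f 2F ≢ f 3F →
  Injective _≡_ _≡_ f
injective₄ f _   _   _   _   _   _   {0F} {0F} _ = refl
injective₄ f d01 _   _   _   _   _   {0F} {1F} e = contradiction e d01
injective₄ f _   d02 _   _   _   _   {0F} {2F} e = contradiction e d02
injective₄ f _   _   d03 _   _   _   {0F} {3F} e = contradiction e d03
injective₄ f d01 _   _   _   _   _   {1F} {0F} e = contradiction (sym e) d01
injective₄ f _   _   _   _   _   _   {1F} {1F} _ = refl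
injective₄ f _   _   _   d12 _   _   {1F} {2F} e = contradiction e d12
injective₄ f _   _   _   _   d13 _   {1F} {3F} e = contradiction e d13
injective₄ f _   d02 _   _   _   _   {2F} {0F} e = contradiction (sym e) d02
injective₄ f _   _   _   d12 _   _   {2F} {1F} e = contradiction (sym e) d12
injective₄ f _   _   _   _   _   _   {2F} {2F} _ = refl
injective₄ f _   _   _   _   _   d23 {2F} {3F} e = contradiction e d23
injective₄ f _   _   d03 _   _   _   {3F} {0F} e = contradiction (sym e) d03
injective₄ f _   _   _   _   d13 _   {3F} {1F} e = contradiction (sym e) d13
injective₄ f _   _   _   _   _   d23 {3F} {2F} e = contradiction (sym e) d23
injective₄ f _   _   _   _   _   _   {3F} {3F} _ = refl

nonempty : ∀ {n} (p : Subset n) → 1 ≤ ∣ p ∣ → Nonempty p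
nonempty (inside  ∷ p) _ = fzero , here
nonempty (outside ∷ p) h = let x , x∈p = nonempty p h in fsuc x , there x∈p

two-elements : ∀ {n} (p : Subset n) → 2 ≤ ∣ p ∣ →
  ∃₂ λ u v → u ∈ p × v ∈ p × toℕ u < toℕ v
two-elements (inside ∷ p) (s≤s h) =
  let x , x∈p = nonempty p h in fzero , fsuc x , here , there x∈p , s≤s z≤n
two-elements (outside ∷ p) h =
  let u , v , u∈p , v∈p , u<v = two-elements p h in fsuc u , fsuc v , there u∈p , there v∈p , s≤s u<v

module _ where
  open import Data.Integer using (+_)

  properAP-middle : ∀ {r} (a : Fin (3 + r) → ℕ) → IsProperAP a → a 0F + a 2F ≡ a 1F + a 1F
  properAP-middle a (d , _ , a≡) = ℤ.+-injective (begin
    + a 0F ℤ.+ + a 2F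
      ≡⟨ cong (ℤ._+_ (+ a 0F)) (a≡ 2F) ⟩
    + a 0F ℤ.+ (+ a 0F ℤ.+ + 2 ℤ.* d)
      ≡⟨ middle (+ a 0F) d ⟩
    (+ a 0F ℤ.+ + 1 ℤ.* d) ℤ.+ (+ a 0F ℤ.+ + 1 ℤ.* d)
      ≡⟨ sym (cong₂ ℤ._+_ (a≡ 1F) (a≡ 1F)) ⟩
    + a 1F ℤ.+ + a 1F ∎)
    where
    open ≡-Reasoning
    middle : ∀ x d → x ℤ.+ (x ℤ.+ + 2 ℤ.* d) ≡ (x ℤ.+ + 1 ℤ.* d) ℤ.+ (x ℤ.+ + 1 ℤ.* d)
    middle = ℤ-Solver.solve-∀

module PermutationMatrix {n : ℕ} {P : Mat n} (isP : IsPermutationMatrix P) where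

  σ : Fin n → Fin n
  σ i = proj₁ (proj₁ (proj₂ isP) i)

  P-σ : ∀ i → P i (σ i) ≡ 1
  P-σ i = proj₁ (proj₂ (proj₁ (proj₂ isP) i))

  P≡1⇒σ : ∀ {i j} → P i j ≡ 1 → j ≡ σ i
  P≡1⇒σ {i} {j} = proj₂ (proj₂ (proj₁ (proj₂ isP) i)) j

  P-≢σ : ∀ {i j} → j ≢ σ i → P i j ≡ 0
  P-≢σ {i} {j} j≢σi with proj₁ isP i j
  ... | inj₁ P≡0 = P≡0
  ... | inj₂ P≡1 = contradiction (P≡1⇒σ P≡1) j≢σi

  σ^ : ℕ → Fin n → Fin n
  σ^ zero    x = x
  σ^ (suc e) x = σ^ e (σ x)

  σ^-+ : ∀ m k x → σ^ (m + k) x ≡ σ^ k (σ^ m x)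
  σ^-+ zero    k x = refl
  σ^-+ (suc m) k x = σ^-+ m k (σ x)

  matPow-σ^ : ∀ e ρ → matPow P e ρ (σ^ e ρ) ≡ 1
  matPow-σ^ zero    ρ = identity-diag n ρ
  matPow-σ^ (suc e) ρ = begin
    sumFin n (λ j → P ρ j * matPow P e j c)
      ≡⟨ sumFin-single n _ (σ ρ) (λ j j≢σρ → cong (_* matPow P e j c) (P-≢σ j≢σρ)) ⟩
    P ρ (σ ρ) * matPow P e (σ ρ) c
      ≡⟨ cong₂ _*_ (P-σ ρ) (matPow-σ^ e (σ ρ)) ⟩
    1 ∎
    where
    open ≡-Reasoning
    c = σ^ e (σ ρ)

  adjacent : ∀ {r} (a : Fin r → ℕ) (S : Subset n) i {j} R C ρ → j ∈ S → C ≡ R + a i * toℕ j →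
    Adj P a S (i , σ^ R ρ) (j , σ^ C ρ)
  adjacent a S i {j} R C ρ j∈S refl =
    j∈S , subst (λ c → matPow P (a i * toℕ j) (σ^ R ρ) c ≡ 1) (sym (σ^-+ R _ ρ)) (matPow-σ^ (a i * toℕ j) (σ^ R ρ))

  σ≗id⇒identity : (∀ x → σ x ≡ x) → ∀ i j → P i j ≡ identity n i j
  σ≗id⇒identity σ≗id i j with i ≟ j
  ... | yes refl = trans (cong (P i) (sym (σ≗id i))) (P-σ i)
  ... | no  i≢j  = P-≢σ (λ j≡σi → i≢j (sym (trans j≡σi (σ≗id i))))

-- Exponent identities for EightCycle below (x, y, z the a-values of its block-rows, U < V its
-- block-columns): exchangeₜ and closing say that row t meets column t + 1, and cross-… bring
-- the exponents of two same-block vertices into the shape required by σ^-cross-injective.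
exchange₀ : ∀ x y z U V → (x * V + (y * V + z * U)) + y * V ≡ (y * V + (y * V + z * U)) + x * V
exchange₀ = solve-∀

exchange₁ : ∀ x y z U V → (x * V + (y * V + y * U)) + z * U ≡ (x * V + (y * V + z * U)) + y * U
exchange₁ = solve-∀

exchange₂ : ∀ x y z U V → (x * V + (z * V + y * U)) + y * V ≡ (x * V + (y * V + y * U)) + z * V
exchange₂ = solve-∀

closing : ∀ x y z U V → x + z ≡ y + y →
  (y * V + (y * V + z * U)) + x * U ≡ (x * V + (z * V + y * U)) + y * U
closing x y z U V x+z≡y+y = begin
  (y * V + (y * V + z * U)) + x * U  ≡⟨ collect y y x z U V ⟩
  (y + y) * V + (x + z) * U          ≡⟨ cong₂ (λ s t → s * V + t * U) (sym x+z≡y+y) x+z≡y+y ⟩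
  (x + z) * V + (y + y) * U          ≡⟨ collect x z y y U V ⟨
  (x * V + (z * V + y * U)) + y * U  ∎
  where
  open ≡-Reasoning
  collect : ∀ a b c d U V → (a * V + (b * V + d * U)) + c * U ≡ (a + b) * V + (c + d) * U
  collect = solve-∀

cross-rows : ∀ x y z U V →
  (x * V + (y * V + z * U)) + (z * V + y * U) ≡ (x * V + (z * V + y * U)) + (y * V + z * U)
cross-rows = solve-∀

cross-cols₀₂ : ∀ x y z U V →
  ((y * V + (y * V + z * U)) + x * U) + (x * V + y * U) ≡ ((x * V + (y * V + y * U)) + z * U) + (y * V + x * U)
cross-cols₀₂ = solve-∀

cross-cols₁₃ : ∀ x y z U V →
  ((x * V + (y * V + z * U)) + y * V) + (z * V + y * U) ≡ ((x * V + (z * V + y * U)) + y * V) + (y * V + z * U)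
cross-cols₁₃ = solve-∀

module CirculantPermutationMatrix {n : ℕ} {P : Mat (suc n)}
  (isP : IsPermutationMatrix P) (circ : IsCirculant P) where

  open PermutationMatrix isP public

  q : ℕ
  q = suc n

  shift : ℕ
  shift = toℕ (σ fzero)

  [m+k%q]%q≡[m+k]%q : ∀ m k → (m + k % q) % q ≡ (m + k) % q
  [m+k%q]%q≡[m+k]%q m k = begin
    (m + k % q) % q             ≡⟨ %-distribˡ-+ m (k % q) q ⟩
    (m % q + k % q % q) % q     ≡⟨ cong (λ t → (m % q + t) % q) (m%n%n≡m%n k q) ⟩
    (m % q + k % q) % q         ≡⟨ %-distribˡ-+ m k q ⟨
    (m + k) % q                 ∎
    where open ≡-Reasoning

  toℕ-mod : ∀ k → toℕ (k mod q) ≡ k % q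
  toℕ-mod k = toℕ-fromℕ< _

  σ-next : ∀ i → σ (next i) ≡ next (σ i)
  σ-next i = sym (P≡1⇒σ (trans (circ i (σ i)) (P-σ i)))

  next-mod : ∀ k → next (k mod q) ≡ suc k mod q
  next-mod k = toℕ-injective (begin
    toℕ (next (k mod q))    ≡⟨ toℕ-mod (suc (toℕ (k mod q))) ⟩
    suc (toℕ (k mod q)) % q ≡⟨ cong (λ t → suc t % q) (toℕ-mod k) ⟩
    (1 + k % q) % q         ≡⟨ [m+k%q]%q≡[m+k]%q 1 k ⟩
    suc k % q               ≡⟨ toℕ-mod (suc k) ⟨
    toℕ (suc k mod q)       ∎)
    where open ≡-Reasoning

  toℕ-σ-mod : ∀ k → toℕ (σ (k mod q)) ≡ (k + shift) % q
  toℕ-σ-mod zero    = sym (m<n⇒m%n≡m (toℕ<n (σ fzero)))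
  toℕ-σ-mod (suc k) = begin
    toℕ (σ (suc k mod q))        ≡⟨ cong (toℕ ∘ σ) (next-mod k) ⟨
    toℕ (σ (next (k mod q)))     ≡⟨ cong toℕ (σ-next (k mod q)) ⟩
    toℕ (next (σ (k mod q)))     ≡⟨ toℕ-mod (suc (toℕ (σ (k mod q)))) ⟩
    suc (toℕ (σ (k mod q))) % q  ≡⟨ cong (λ t → suc t % q) (toℕ-σ-mod k) ⟩
    (1 + (k + shift) % q) % q    ≡⟨ [m+k%q]%q≡[m+k]%q 1 (k + shift) ⟩
    (suc k + shift) % q          ∎
    where open ≡-Reasoning

  toℕ-σ : ∀ x → toℕ (σ x) ≡ (toℕ x + shift) % q
  toℕ-σ x = trans (cong (toℕ ∘ σ) (sym toℕx-mod)) (toℕ-σ-mod (toℕ x))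
    where
    toℕx-mod : toℕ x mod q ≡ x
    toℕx-mod = toℕ-injective (trans (toℕ-mod (toℕ x)) (m<n⇒m%n≡m (toℕ<n x)))

  toℕ-σ^ : ∀ m x → toℕ (σ^ m x) ≡ (toℕ x + m * shift) % q
  toℕ-σ^ zero    x = sym (trans (cong (_% q) (+-identityʳ (toℕ x))) (m<n⇒m%n≡m (toℕ<n x)))
  toℕ-σ^ (suc m) x = begin
    toℕ (σ^ m (σ x))                       ≡⟨ toℕ-σ^ m (σ x) ⟩
    (toℕ (σ x) + m * shift) % q            ≡⟨ cong (λ t → (t + m * shift) % q) (toℕ-σ x) ⟩
    ((toℕ x + shift) % q + m * shift) % q  ≡⟨ cong (_% q) (+-comm _ (m * shift)) ⟩
    (m * shift + (toℕ x + shift) % q) % q  ≡⟨ [m+k%q]%q≡[m+k]%q (m * shift) (toℕ x + shift) ⟩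
    (m * shift + (toℕ x + shift)) % q      ≡⟨ cong (_% q) (reorder (toℕ x) shift m) ⟩
    (toℕ x + suc m * shift) % q            ∎
    where
    open ≡-Reasoning
    reorder : ∀ x s m → m * s + (x + s) ≡ x + suc m * s
    reorder = solve-∀

  σ^-fixed⇒q∣m*shift : ∀ m x → σ^ m x ≡ x → q ∣ m * shift
  σ^-fixed⇒q∣m*shift m x fixed =
    divides (X / q) (+-cancelʳ-≡ (toℕ x) _ _ (begin
      m * shift + toℕ x      ≡⟨ +-comm (m * shift) (toℕ x) ⟩
      X                      ≡⟨ m≡m%n+[m/n]*n X q ⟩
      X % q + X / q * q      ≡⟨ cong (_+ X / q * q) (toℕ-σ^ m x) ⟨
      toℕ (σ^ m x) + X / q * q ≡⟨ cong (λ y → toℕ y + X / q * q) fixed ⟩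
      toℕ x + X / q * q      ≡⟨ +-comm (toℕ x) _ ⟩
      X / q * q + toℕ x      ∎))
    where
    open ≡-Reasoning
    X = toℕ x + m * shift

  shift≡0⇒identity : shift ≡ 0 → ∀ i j → P i j ≡ identity q i j
  shift≡0⇒identity shift≡0 = σ≗id⇒identity λ x → toℕ-injective (begin
    toℕ (σ x)              ≡⟨ toℕ-σ x ⟩
    (toℕ x + shift) % q    ≡⟨ cong (λ s → (toℕ x + s) % q) shift≡0 ⟩
    (toℕ x + 0) % q        ≡⟨ cong (_% q) (+-identityʳ (toℕ x)) ⟩
    toℕ x % q              ≡⟨ m<n⇒m%n≡m (toℕ<n x) ⟩
    toℕ x                  ∎)
    where open ≡-Reasoning

  module NonIdentityOfPrimeSize (q-prime : Prime q) (P≢I : ¬ (∀ i j → P i j ≡ identity q i j)) where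

    σ^-fixed⇒q∣ : ∀ m x → σ^ m x ≡ x → q ∣ m
    σ^-fixed⇒q∣ m x fixed with euclidsLemma m shift q-prime (σ^-fixed⇒q∣m*shift m x fixed)
    ... | inj₁ q∣m     = q∣m
    ... | inj₂ q∣shift = contradiction q∣shift (>⇒∤ {{nonZero}} (toℕ<n (σ fzero)))
      where
      nonZero : NonZero shift
      nonZero with shift in eq
      ... | zero  = contradiction (shift≡0⇒identity eq) P≢I
      ... | suc _ = _

    σ^-no-fixed-point : ∀ {d D} x → suc d < q → suc D < q → σ^ (suc d * suc D) x ≢ x
    σ^-no-fixed-point {d} {D} x d<q D<q fixed with euclidsLemma (suc d) (suc D) q-prime (σ^-fixed⇒q∣ _ x fixed)
    ... | inj₁ q∣d = >⇒∤ d<q q∣d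
    ... | inj₂ q∣D = >⇒∤ D<q q∣D

    σ^-cross-injective< : ∀ {x y U V} M N w → x < y → y < q → U < V → V < q →
      M + (x * V + y * U) ≡ N + (y * V + x * U) → σ^ M w ≢ σ^ N w
    σ^-cross-injective< {x} {y} {U} {V} M N w x<y y<q U<V V<q eq
      with m≤n⇒∃[o]m+o≡n x<y | m≤n⇒∃[o]m+o≡n U<V
    ... | k , refl | K , refl = λ σ^M≡σ^N → σ^-no-fixed-point (σ^ N w)
      (≤-<-trans (s≤s (m≤n+m k x)) y<q) (≤-<-trans (s≤s (m≤n+m K U)) V<q) (begin
        σ^ (suc k * suc K) (σ^ N w)  ≡⟨ σ^-+ N _ w ⟨
        σ^ (N + suc k * suc K) w     ≡⟨ cong (λ m → σ^ m w) M≡N+kK ⟨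
        σ^ M w                       ≡⟨ σ^M≡σ^N ⟩
        σ^ N w                       ∎)
      where
      open ≡-Reasoning
      cross : ∀ N x k U K → N + ((suc x + k) * (suc U + K) + x * U)
                          ≡ (N + suc k * suc K) + (x * (suc U + K) + (suc x + k) * U)
      cross = solve-∀
      M≡N+kK : M ≡ N + suc k * suc K
      M≡N+kK = +-cancelʳ-≡ _ M _ (trans eq (cross N x k U K))

    σ^-cross-injective : ∀ {x y U V} M N w → x ≢ y → x < q → y < q → U < V → V < q →
      M + (x * V + y * U) ≡ N + (y * V + x * U) → σ^ M w ≢ σ^ N w
    σ^-cross-injective {x} {y} M N w x≢y x<q y<q U<V V<q eq with <-cmp x y
    ... | tri< x<y _ _ = σ^-cross-injective< M N w x<y y<q U<V V<q eq
    ... | tri≈ _ x≡y _ = contradiction x≡y x≢y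
    ... | tri> _ _ y<x = σ^-cross-injective< N M w y<x x<q U<V V<q (sym eq) ∘ sym

    module EightCycle {r} (a : Fin r → ℕ) (S : Subset q) (i₀ i₁ i₂ : Fin r) (u v : Fin q)
      (a<q : ∀ i → a i < q) (x≢y : a i₀ ≢ a i₁) (z≢y : a i₂ ≢ a i₁) (x≢z : a i₀ ≢ a i₂)
      (x+z≡y+y : a i₀ + a i₂ ≡ a i₁ + a i₁) (u∈S : u ∈ S) (v∈S : v ∈ S) (U<V : toℕ u < toℕ v) where

      x y z U V : ℕ
      x = a i₀
      y = a i₁
      z = a i₂
      U = toℕ u
      V = toℕ v

      -- Every vertex is σ^ e 0.  Row t has exponent rₜ and column t has rₜ + a(iₜ)·jₜ, so each
      -- row meets its own column by construction.
      r₀ r₁ r₂ r₃ : ℕ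
      r₀ = y * V + (y * V + z * U)
      r₁ = x * V + (y * V + z * U)
      r₂ = x * V + (y * V + y * U)
      r₃ = x * V + (z * V + y * U)

      rows : Fin 4 → RowV r q
      rows 0F = i₀ , σ^ r₀ fzero
      rows 1F = i₁ , σ^ r₁ fzero
      rows 2F = i₂ , σ^ r₂ fzero
      rows 3F = i₁ , σ^ r₃ fzero

      cols : Fin 4 → ColV q
      cols 0F = u , σ^ (r₀ + x * U) fzero
      cols 1F = v , σ^ (r₁ + y * V) fzero
      cols 2F = u , σ^ (r₂ + z * U) fzero
      cols 3F = v , σ^ (r₃ + y * V) fzero

      adj₁ : ∀ t → Adj P a S (rows t) (cols t)
      adj₁ 0F = adjacent a S i₀ r₀ _ fzero u∈S refl
      adj₁ 1F = adjacent a S i₁ r₁ _ fzero v∈S refl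
      adj₁ 2F = adjacent a S i₂ r₂ _ fzero u∈S refl
      adj₁ 3F = adjacent a S i₁ r₃ _ fzero v∈S refl

      adj₂ : ∀ t → Adj P a S (rows t) (cols (next t))
      adj₂ 0F = adjacent a S i₀ r₀ _ fzero v∈S (exchange₀ x y z U V)
      adj₂ 1F = adjacent a S i₁ r₁ _ fzero u∈S (exchange₁ x y z U V)
      adj₂ 2F = adjacent a S i₂ r₂ _ fzero v∈S (exchange₂ x y z U V)
      adj₂ 3F = adjacent a S i₁ r₃ _ fzero u∈S (closing x y z U V x+z≡y+y)

      distinct-rows : ∀ {i i′} {ρ ρ′ : Fin q} → a i ≢ a i′ → (i , ρ) ≢ (i′ , ρ′)
      distinct-rows a≢ e = a≢ (cong (a ∘ proj₁) e)

      u≢v : ∀ {c c′ : Fin q} → (u , c) ≢ (v , c′)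
      u≢v e = <-irrefl (cong (toℕ ∘ proj₁) e) U<V

      v≢u : ∀ {c c′ : Fin q} → (v , c) ≢ (u , c′)
      v≢u = u≢v ∘ sym

      distinct-positions : ∀ {B : Set} {b : B} {c c′ : Fin q} → c ≢ c′ → (b , c) ≢ (b , c′)
      distinct-positions c≢c′ = c≢c′ ∘ cong proj₂

      cross : ∀ {x′ y′} M N → x′ ≢ y′ → x′ < q → y′ < q →
        M + (x′ * V + y′ * U) ≡ N + (y′ * V + x′ * U) → σ^ M fzero ≢ σ^ N fzero
      cross M N x′≢y′ x′<q y′<q = σ^-cross-injective M N fzero x′≢y′ x′<q y′<q U<V (toℕ<n v)

      rows-injective : Injective _≡_ _≡_ rows
      rows-injective = injective₄ rows
        (distinct-rows x≢y) (distinct-rows x≢z) (distinct-rows x≢y) (distinct-rows (z≢y ∘ sym))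
        (distinct-positions (cross r₁ r₃ z≢y (a<q i₂) (a<q i₁) (cross-rows x y z U V)))
        (distinct-rows z≢y)

      cols-injective : Injective _≡_ _≡_ cols
      cols-injective = injective₄ cols u≢v
        (distinct-positions
          (cross (r₀ + x * U) (r₂ + z * U) x≢y (a<q i₀) (a<q i₁) (cross-cols₀₂ x y z U V)))
        u≢v v≢u
        (distinct-positions
          (cross (r₁ + y * V) (r₃ + y * V) z≢y (a<q i₂) (a<q i₁) (cross-cols₁₃ x y z U V)))
        u≢v

      cycle : Cycle P a S 4
      cycle = record
        { two≤k = s≤s (s≤s z≤n) ; cols = cols ; rows = rows
        ; colsInj = cols-injective ; rowsInj = rows-injective ; adj₁ = adj₁ ; adj₂ = adj₂ }

lemma1 : (q : ℕ) → Prime q → q % 2 ≡ 1 →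
    (P : Mat q) → IsCirculantPermutationMatrix P → ¬ (∀ i j → P i j ≡ identity q i j) →
    (r : ℕ) → 3 ≤ r → r ≤ q →
    (a : Fin r → ℕ) → (∀ i → a i < q) → Injective _≡_ _≡_ a → IsProperAP a →
    (S : Subset q) → 2 ≤ ∣ S ∣ →
    GirthAtMost P a S 8
lemma1 zero _ _ _ _ _ _ _ _ _ _ _ _ [] ()
lemma1 (suc n) q-prime _ P (isP , circ) P≢I r (s≤s (s≤s (s≤s _))) _ a a<q a-injective ap S 2≤∣S∣ =
  4 , ≤-refl , cycle
  where
  open CirculantPermutationMatrix isP circ
  open NonIdentityOfPrimeSize q-prime P≢I

  distinct : ∀ {i j} → i ≢ j → a i ≢ a j
  distinct i≢j = i≢j ∘ a-injective

  cycle : Cycle P a S 4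
  cycle with two-elements S 2≤∣S∣
  ... | u , v , u∈S , v∈S , U<V = EightCycle.cycle a S 0F 1F 2F u v a<q
    (distinct λ ()) (distinct λ ()) (distinct λ ()) (properAP-middle a ap) u∈S v∈S U<V
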